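{- Let $\mathcal{K}$ be a regular incidence complex of rank $n\ge 1$, let $\Gamma$ be a flag-transitive subgroup of $\Gamma(\mathcal{K})$, let $\Phi=\{F_{ -1},F_0,\dots,F_n\}$ be a flag of $\mathcal{K}$ with $F_i$ of rank $i$, and let $N=\{ -1,0,\dots,n\}$. For $k\in N$ let $R_k=\{\varphi\in\Gamma: F_l\varphi=F_l\text{ for all } l\ne k\}$; for nonempty $I\subseteq N$ let $\Gamma_I=\langle R_k: k\in I\rangle$, and $\Gamma_\emptyset=R_{ -1}$; put $\Gamma_k=\Gamma_{N\setminus\{k\}}$, $\Gamma_k^-=\Gamma_{\{ -1,0,\dots,k\}}$ and $\Gamma_k^+=\Gamma_{\{k,\dots,n\}}$. Let $0\le i\le j\le n-1$ and $\varphi,\psi\in\Gamma$. Then the following are equivalent: (a) $F_i\varphi\le F_j\psi$; (b) $\varphi\psi^{ -1}\in\Gamma_{i+1}^+\Gamma_{j-1}^-$; (c) $\Gamma_i\varphi\cap\Gamma_j\psi\neq\emptyset$.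
   Context: A partially ordered set $\mathcal{K}$ is an incidence complex of rank $n$ if: (I1) it has a least face and a greatest face; (I2) every chain is contained in a maximal chain (flag) with exactly $n+2$ elements (giving a rank function with values $-1,\dots,n$, each flag containing one face of each rank); (I3) every section $G/F=\{H: F\le H\le G\}$ (including $\mathcal{K}$) is connected, where a poset of rank $\le1$ is connected and one of rank $\ge2$ is connected if any two proper faces are joined by a finite sequence of proper faces with consecutive members comparable; (I4) for $i=0,\dots,n-1$, whenever $F<G$ with ranks $i-1$ and $i+1$ there are at least two $i$-faces strictly between them. $\Gamma(\mathcal{K})$ is the group of order-preserving bijections $\mathcal{K}\to\mathcal{K}$ (with order-preserving inverse); $\mathcal{K}$ is regular if $\Gamma(\mathcal{K})$ is transitive on flags; a subgroup $\Gamma\le\Gamma(\mathcal{K})$ is flag-transitive if it is transitive on flags. Automorphisms act on the right: $F\varphi$ is the image of $F$ under $\varphi$, and $\varphi\psi$ means first apply $\varphi$, then $\psi$. Products of subgroups such as $\Gamma_{i+1}^+\Gamma_{j-1}^-$ are products of subsets. -}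

module Defs where

open import Level using (0ℓ)
open import Data.Nat using (ℕ; zero; suc; _+_; _≤_)
open import Data.Fin using (Fin; toℕ; inject₁) renaming (suc to fsuc; zero to fzero)
open import Data.Product using (Σ; ∃; _×_; _,_)
open import Data.Sum using (_⊎_)
open import Relation.Nullary using (¬_)
open import Relation.Binary.PropositionalEquality using (_≡_; _≢_)
open import Relation.Binary.Structures using (IsPartialOrder)
open import Function.Definitions using (Injective)
open import Function.Bundles using (_⇔_)

record PosetR : Set₁ where
  field
    Carrier : Set
    _≤ᴾ_    : Carrier → Carrier → Set
    isPO    : IsPartialOrder _≡_ _≤ᴾ_

module _ (P : PosetR) where
  open PosetR P

  _<ᴾ_ : Carrier → Carrier → Set
  x <ᴾ y = (x ≤ᴾ y) × (x ≢ y)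

  Comparable : Carrier → Carrier → Set
  Comparable x y = (x ≤ᴾ y) ⊎ (y ≤ᴾ x)

  IsChain : (Carrier → Set) → Set
  IsChain C = ∀ x y → C x → C y → Comparable x y

  IsFlag : (Carrier → Set) → Set₁
  IsFlag C = IsChain C ×
    ((C' : Carrier → Set) → IsChain C' → (∀ x → C x → C' x) → ∀ x → C' x → C x)

  HasSize : (Carrier → Set) → ℕ → Set
  HasSize S m = Σ (Fin m → Carrier) λ f →
    Injective _≡_ _≡_ f × (∀ x → S x ⇔ (∃ λ r → f r ≡ x))

  -- RankIs F r : F has rank r - 1 (r is the number of faces strictly below F
  -- in some flag containing F; this is the rank function given by (I2))
  RankIs : Carrier → ℕ → Set₁
  RankIs F r = Σ (Carrier → Set) λ Φ → IsFlag Φ × Φ F × HasSize (λ x → Φ x × x <ᴾ F) r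

  data PathIn (Q : Carrier → Set) : Carrier → Carrier → Set where
    here : ∀ {x} → PathIn Q x x
    step : ∀ {x y z} → Comparable x y → Q y → PathIn Q y z → PathIn Q x z

  record IsIncidenceComplex (n : ℕ) : Set₁ where
    field
      least    : ∃ λ b → ∀ x → b ≤ᴾ x
      greatest : ∃ λ t → ∀ x → x ≤ᴾ t
      chain-in-flag : (C : Carrier → Set) → IsChain C →
                      Σ (Carrier → Set) λ Φ → IsFlag Φ × (∀ x → C x → Φ x)
      flag-size     : (Φ : Carrier → Set) → IsFlag Φ → HasSize Φ (suc (suc n))
      -- (I3): sections G/F of rank ≥ 2 (rank G − rank F − 1 ≥ 2) are connected
      connected : ∀ F G a b → F ≤ᴾ G → RankIs F a → RankIs G b → a + 3 ≤ b →
                  ∀ H H' → (F <ᴾ H × H <ᴾ G) → (F <ᴾ H' × H' <ᴾ G) →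
                  PathIn (λ K → F <ᴾ K × K <ᴾ G) H H'
      -- (I4): F of rank i−1, G of rank i+1 (i = 0..n−1, automatic here)
      diamond : ∀ F G a → F <ᴾ G → RankIs F a → RankIs G (2 + a) →
                ∃ λ H → ∃ λ H' → H ≢ H' ×
                  (F <ᴾ H × H <ᴾ G × RankIs H (suc a)) ×
                  (F <ᴾ H' × H' <ᴾ G × RankIs H' (suc a))

  record Aut : Set where
    field
      to      : Carrier → Carrier
      from    : Carrier → Carrier
      to-from : ∀ x → to (from x) ≡ x
      from-to : ∀ x → from (to x) ≡ x
      to-mono   : ∀ {x y} → x ≤ᴾ y → to x ≤ᴾ to y
      from-mono : ∀ {x y} → x ≤ᴾ y → from x ≤ᴾ from y
  open Aut public

  -- right action: F ∙ᴬ φ is the image of F under φ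
  _·_ : Carrier → Aut → Carrier
  F · φ = to φ F

  _≈ᴬ_ : Aut → Aut → Set
  φ ≈ᴬ ψ = ∀ x → to φ x ≡ to ψ x

  idᴬ : Aut
  idᴬ = record { to = λ x → x ; from = λ x → x ; to-from = λ _ → Relation.Binary.PropositionalEquality.refl
               ; from-to = λ _ → Relation.Binary.PropositionalEquality.refl ; to-mono = λ p → p ; from-mono = λ p → p }

  -- φ ∘ᴬ ψ : first apply φ, then ψ
  _∘ᴬ_ : Aut → Aut → Aut
  φ ∘ᴬ ψ = record
    { to = λ x → to ψ (to φ x)
    ; from = λ x → from φ (from ψ x)
    ; to-from = λ x → Relation.Binary.PropositionalEquality.trans
        (Relation.Binary.PropositionalEquality.cong (to ψ) (to-from φ (from ψ x))) (to-from ψ x)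
    ; from-to = λ x → Relation.Binary.PropositionalEquality.trans
        (Relation.Binary.PropositionalEquality.cong (from φ) (from-to ψ (to φ x))) (from-to φ x)
    ; to-mono = λ p → to-mono ψ (to-mono φ p)
    ; from-mono = λ p → from-mono φ (from-mono ψ p) }

  _⁻¹ᴬ : Aut → Aut
  φ ⁻¹ᴬ = record { to = from φ ; from = to φ ; to-from = from-to φ ; from-to = to-from φ
                 ; to-mono = from-mono φ ; from-mono = to-mono φ }

  record IsSubgroup (Γ : Aut → Set) : Set where
    field
      resp  : ∀ {φ ψ} → φ ≈ᴬ ψ → Γ φ → Γ ψ
      id∈   : Γ idᴬ
      ∘∈    : ∀ {φ ψ} → Γ φ → Γ ψ → Γ (φ ∘ᴬ ψ)
      ⁻¹∈   : ∀ {φ} → Γ φ → Γ (φ ⁻¹ᴬ)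

  MapsFlagTo : Aut → (Carrier → Set) → (Carrier → Set) → Set
  MapsFlagTo φ Φ Ψ = ∀ x → Φ x ⇔ Ψ (x · φ)

  FlagTransitive : (Aut → Set) → Set₁
  FlagTransitive Γ = (Φ Ψ : Carrier → Set) → IsFlag Φ → IsFlag Ψ →
                     ∃ λ φ → Γ φ × MapsFlagTo φ Φ Ψ

  IsRegular : Set₁
  IsRegular = FlagTransitive (λ _ → ⊤′)
    where open import Data.Unit renaming (⊤ to ⊤′)

  data Gen (S : Aut → Set) : Aut → Set where
    gen  : ∀ {φ} → S φ → Gen S φ
    gid  : Gen S idᴬ
    gcomp : ∀ {φ ψ} → Gen S φ → Gen S ψ → Gen S (φ ∘ᴬ ψ)
    ginv : ∀ {φ} → Gen S φ → Gen S (φ ⁻¹ᴬ)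
    gresp : ∀ {φ ψ} → φ ≈ᴬ ψ → Gen S φ → Gen S ψ

  -- Base flag: Φ r is the face F_{r−1} of rank r − 1, r = 0,…,n+1
  IsBaseFlag : (n : ℕ) → (Fin (suc (suc n)) → Carrier) → Set₁
  IsBaseFlag n F = IsFlag (λ x → ∃ λ r → F r ≡ x) × (∀ r → RankIs (F r) (toℕ r))

  module _ {n : ℕ} (Γ : Aut → Set) (F : Fin (suc (suc n)) → Carrier) where
    -- R_k (k given by its index r, rank r − 1)
    R : Fin (suc (suc n)) → Aut → Set
    R k φ = Γ φ × (∀ l → l ≢ k → F l · φ ≡ F l)

    -- Γ_I for I ⊆ N (indices); Γ_∅ = R_{−1}
    ΓI : (Fin (suc (suc n)) → Set) → Aut → Set
    ΓI I = Gen (λ φ → (∃ λ k → I k × R k φ) ⊎ ((∀ k → ¬ I k) × R fzero φ))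

    -- Γ_i = Γ_{N∖{i}}, for rank i ∈ {0,…,n−1} given as i : Fin n
    Γ-at : Fin n → Aut → Set
    Γ-at i = ΓI (λ l → l ≢ fsuc (inject₁ i))

    -- Γ⁺_{i+1} = Γ_{{i+1,…,n}} (indices ≥ i+2)
    Γ⁺-succ : Fin n → Aut → Set
    Γ⁺-succ i = ΓI (λ l → suc (suc (toℕ i)) ≤ toℕ l)

    -- Γ⁻_{j−1} = Γ_{{−1,…,j−1}} (indices ≤ j)
    Γ⁻-pred : Fin n → Aut → Set
    Γ⁻-pred j = ΓI (λ l → toℕ l ≤ toℕ j)

    face : Fin n → Carrier
    face i = F (fsuc (inject₁ i))

module Submission where

-- Orbit lemma: every face of the
--    section F_b/F_a is the image of a base face under Γ⟨a,b⟩ (induction on the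
--    width, using connectivity (I3)).  Stabiliser lemma: every element of Γ
--    fixing the base faces outside (a,b) lies in Γ⟨a,b⟩ (peel off F_{a+1} with
--    the orbit lemma and recurse).
--  * The theorem: (a)⇒(b) factors φψ⁻¹ through a flag containing F_iφψ⁻¹ and the
--    upper part of the base flag and applies the stabiliser lemma to both
--    factors; (b)⇒(a), (b)⇒(c) and (c)⇒(a) are computations with fixed faces.

open import Defs
open import Data.Nat using (ℕ; _≤_)
open import Data.Fin using (Fin) renaming (_≤_ to _≤ᶠ_)
open import Data.Product using (∃; _×_)
open import Function.Bundles using (_⇔_)

open import Data.Nat using (zero; suc; _+_; z≤n; s≤s) renaming (_<_ to _<ℕ_)
import Data.Nat.Properties as ℕP
open import Data.Fin using (toℕ; inject₁; splitAt; join; _↑ˡ_; _↑ʳ_; fromℕ; fromℕ<)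
  renaming (suc to fsuc; zero to fzero)
import Data.Fin.Properties as FinP
open import Data.Product using (Σ; _,_; proj₁; proj₂)
open import Data.Sum using (_⊎_; inj₁; inj₂)
open import Data.Empty using (⊥; ⊥-elim)
open import Relation.Nullary using (¬_; Dec; yes; no)
open import Relation.Binary.PropositionalEquality
open import Relation.Binary.Structures using (IsPartialOrder)
open import Function.Bundles using (mk⇔; Equivalence)
open import Function.Definitions using (Injective)

module ⇔ = Equivalence

enumerate : (N : ℕ) (Q : Fin N → Set) → (∀ i → Dec (Q i)) →
  Σ ℕ λ m → Σ (Fin m → Fin N) λ g → Injective _≡_ _≡_ g × (∀ i → Q i ⇔ ∃ λ r → g r ≡ i)
enumerate zero Q d = zero , (λ ()) , (λ { {()} }) , λ ()
enumerate (suc N) Q d with enumerate N (λ i → Q (fsuc i)) (λ i → d (fsuc i)) | d fzero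
... | m , g , g-inj , g-enum | yes q0 = suc m , h , h-inj , h-enum
  where
    h : Fin (suc m) → Fin (suc N)
    h fzero = fzero
    h (fsuc r) = fsuc (g r)
    h-inj : Injective _≡_ _≡_ h
    h-inj {fzero} {fzero} e = refl
    h-inj {fsuc x} {fsuc y} e = cong fsuc (g-inj (FinP.suc-injective e))
    h-enum : ∀ i → Q i ⇔ ∃ λ r → h r ≡ i
    h-enum fzero = mk⇔ (λ _ → fzero , refl) (λ _ → q0)
    h-enum (fsuc i) = mk⇔
      (λ q → let (r , e) = ⇔.to (g-enum i) q in fsuc r , cong fsuc e)
      (λ { (fzero , ()) ; (fsuc r , e) → ⇔.from (g-enum i) (r , FinP.suc-injective e) })
... | m , g , g-inj , g-enum | no ¬q0 = m , h , h-inj , h-enum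
  where
    h : Fin m → Fin (suc N)
    h r = fsuc (g r)
    h-inj : Injective _≡_ _≡_ h
    h-inj e = g-inj (FinP.suc-injective e)
    h-enum : ∀ i → Q i ⇔ ∃ λ r → h r ≡ i
    h-enum fzero = mk⇔ (λ q → ⊥-elim (¬q0 q)) (λ { (r , ()) })
    h-enum (fsuc i) = mk⇔
      (λ q → let (r , e) = ⇔.to (g-enum i) q in r , cong fsuc e)
      (λ { (r , e) → ⇔.from (g-enum i) (r , FinP.suc-injective e) })

module Cardinality (P : PosetR) where
  open PosetR P

  Size : (Carrier → Set) → ℕ → Set
  Size = HasSize P

  element : ∀ {S N} (sz : Size S N) (r : Fin N) → S (proj₁ sz r)
  element (f , _ , enum) r = ⇔.from (enum (f r)) (r , refl)

  injection-bound : ∀ {S q p} → Size S q → (g : Fin p → Carrier) →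
                    Injective _≡_ _≡_ g → (∀ r → S (g r)) → p ≤ q
  injection-bound (f , _ , enum) g g-inj gS = FinP.injective⇒≤ index-inj
    where
      index : ∀ r → ∃ λ k → f k ≡ g r
      index r = ⇔.to (enum (g r)) (gS r)
      index-inj : Injective _≡_ _≡_ (λ r → proj₁ (index r))
      index-inj {r} {r'} e =
        g-inj (trans (sym (proj₂ (index r))) (trans (cong f e) (proj₂ (index r'))))

  size-unique : ∀ {S m m'} → Size S m → Size S m' → m ≡ m'
  size-unique sz@(f , f-inj , _) sz'@(f' , f'-inj , _) =
    ℕP.≤-antisym (injection-bound sz' f f-inj (element sz))
                 (injection-bound sz f' f'-inj (element sz'))

  size-cong : ∀ {S S' m} → (∀ x → S x ⇔ S' x) → Size S m → Size S' m
  size-cong e (f , f-inj , enum) =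
    f , f-inj , λ x → mk⇔ (λ s' → ⇔.to (enum x) (⇔.from (e x) s'))
                          (λ w → ⇔.to (e x) (⇔.from (enum x) w))

  size-singleton : (x : Carrier) → Size (_≡ x) 1
  size-singleton x = (λ _ → x) , (λ { {fzero} {fzero} _ → refl })
                   , λ u → mk⇔ (λ e → fzero , sym e) (λ (_ , e) → sym e)

  size-disjoint-union : ∀ {A B p q} → Size A p → Size B q → (∀ u → A u → B u → ⊥) →
                        Size (λ u → A u ⊎ B u) (p + q)
  size-disjoint-union {A} {B} {p} {q} (fA , fA-inj , enumA) (fB , fB-inj , enumB) disjoint =
    f , f-inj , enum
    where
      f⊎ : Fin p ⊎ Fin q → Carrier
      f⊎ (inj₁ a) = fA a
      f⊎ (inj₂ b) = fB b
      f⊎-inj : Injective _≡_ _≡_ f⊎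
      f⊎-inj {inj₁ a} {inj₁ a'} e = cong inj₁ (fA-inj e)
      f⊎-inj {inj₁ a} {inj₂ b} e =
        ⊥-elim (disjoint _ (⇔.from (enumA _) (a , refl)) (⇔.from (enumB _) (b , sym e)))
      f⊎-inj {inj₂ b} {inj₁ a} e =
        ⊥-elim (disjoint _ (⇔.from (enumA _) (a , refl)) (⇔.from (enumB _) (b , e)))
      f⊎-inj {inj₂ b} {inj₂ b'} e = cong inj₂ (fB-inj e)
      f : Fin (p + q) → Carrier
      f x = f⊎ (splitAt p x)
      f-inj : Injective _≡_ _≡_ f
      f-inj {x} {y} e = begin
        x                       ≡⟨ FinP.join-splitAt p q x ⟨
        join p q (splitAt p x)  ≡⟨ cong (join p q) (f⊎-inj {splitAt p x} {splitAt p y} e) ⟩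
        join p q (splitAt p y)  ≡⟨ FinP.join-splitAt p q y ⟩
        y                       ∎
        where open ≡-Reasoning
      from-index : ∀ {u} z → f⊎ z ≡ u → A u ⊎ B u
      from-index (inj₁ a) e = inj₁ (⇔.from (enumA _) (a , e))
      from-index (inj₂ b) e = inj₂ (⇔.from (enumB _) (b , e))
      to-index : ∀ {u} → A u ⊎ B u → ∃ λ r → f r ≡ u
      to-index {u} (inj₁ a) = let (r , e) = ⇔.to (enumA u) a
        in r ↑ˡ q , trans (cong f⊎ (FinP.splitAt-↑ˡ p r q)) e
      to-index {u} (inj₂ b) = let (r , e) = ⇔.to (enumB u) b
        in p ↑ʳ r , trans (cong f⊎ (FinP.splitAt-↑ʳ p q r)) e
      enum : ∀ u → (A u ⊎ B u) ⇔ ∃ λ r → f r ≡ u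
      enum u = mk⇔ to-index (λ (r , e) → from-index (splitAt p r) e)

  size-filter : ∀ {S N} (Q : Carrier → Set) (sz : Size S N) → (∀ r → Dec (Q (proj₁ sz r))) →
                Σ ℕ λ m → Size (λ u → S u × Q u) m
  size-filter {S} Q (f , f-inj , enum) d with enumerate _ (λ r → Q (f r)) d
  ... | m , g , g-inj , g-enum = m , (λ r → f (g r)) , (λ e → g-inj (f-inj e)) , enum'
    where
      to-index : ∀ {u} → S u × Q u → ∃ λ r → f (g r) ≡ u
      to-index {u} (s , q) =
        let (k , e) = ⇔.to (enum u) s
            (r , e') = ⇔.to (g-enum k) (subst Q (sym e) q)
        in r , trans (cong f e') e
      enum' : ∀ u → (S u × Q u) ⇔ ∃ λ r → f (g r) ≡ u
      enum' u = mk⇔ to-index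
        (λ { (r , refl) → ⇔.from (enum _) (g r , refl) , ⇔.from (g-enum (g r)) (r , refl) })

  decide-equal : ∀ {S N u x} → Size S N → S u → S x → Dec (u ≡ x)
  decide-equal {u = u} {x} (f , f-inj , enum) Su Sx
    with ⇔.to (enum u) Su | ⇔.to (enum x) Sx
  ... | k , refl | l , refl with k FinP.≟ l
  ...   | yes refl = yes refl
  ...   | no k≢l = no (λ e → k≢l (f-inj e))

module PosetFacts (P : PosetR) where
  open PosetR P
  open IsPartialOrder isPO public
    using () renaming (refl to ≤ᴾ-refl; trans to ≤ᴾ-trans; antisym to ≤ᴾ-antisym)

  _<_ : Carrier → Carrier → Set
  _<_ = _<ᴾ_ P

  <-irrefl : ∀ {u} → ¬ (u < u)
  <-irrefl (_ , u≢u) = u≢u refl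

  <-asym : ∀ {u x} → u < x → ¬ (x < u)
  <-asym (u≤x , u≢x) (x≤u , _) = u≢x (≤ᴾ-antisym u≤x x≤u)

  <-trans : ∀ {u x y} → u < x → x < y → u < y
  <-trans u<x@(u≤x , _) x<y@(x≤y , _) =
    ≤ᴾ-trans u≤x x≤y , λ { refl → <-asym u<x x<y }

  Flag : (Carrier → Set) → Set₁
  Flag = IsFlag P

  flag-maximal : ∀ {Θ} → Flag Θ → ∀ u → (∀ w → Θ w → Comparable P w u) → Θ u
  flag-maximal {Θ} (chain , maximal) u comparable =
    maximal (λ w → Θ w ⊎ w ≡ u) extended-chain (λ _ → inj₁) u (inj₂ refl)
    where
      extended-chain : IsChain P (λ w → Θ w ⊎ w ≡ u)
      extended-chain a b (inj₁ Θa) (inj₁ Θb) = chain a b Θa Θb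
      extended-chain a b (inj₁ Θa) (inj₂ refl) = comparable a Θa
      extended-chain a b (inj₂ refl) (inj₁ Θb) with comparable b Θb
      ... | inj₁ b≤a = inj₂ b≤a
      ... | inj₂ a≤b = inj₁ a≤b
      extended-chain a b (inj₂ refl) (inj₂ refl) = inj₁ ≤ᴾ-refl

  to-injective : ∀ (β : Aut P) {x y} → to β x ≡ to β y → x ≡ y
  to-injective β {x} {y} e = trans (sym (from-to β x)) (trans (cong (from β) e) (from-to β y))

  to-< : ∀ (β : Aut P) {x y} → x < y → to β x < to β y
  to-< β (x≤y , x≢y) = to-mono β x≤y , λ e → x≢y (to-injective β e)

  from-< : ∀ (β : Aut P) {x y} → x < y → from β x < from β y
  from-< β = to-< (_⁻¹ᴬ P β)

  from-fixed : ∀ (β : Aut P) {x} → to β x ≡ x → from β x ≡ x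
  from-fixed β {x} e = trans (cong (from β) (sym e)) (from-to β x)

  preserve-comparable : ∀ (β : Aut P) {a b} → Comparable P a b → Comparable P (to β a) (to β b)
  preserve-comparable β (inj₁ le) = inj₁ (to-mono β le)
  preserve-comparable β (inj₂ le) = inj₂ (to-mono β le)

  reflect-comparable : ∀ (β : Aut P) {a b} → Comparable P (to β a) (to β b) → Comparable P a b
  reflect-comparable β {a} {b} c =
    subst₂ (Comparable P) (from-to β a) (from-to β b) (preserve-comparable (_⁻¹ᴬ P β) c)

  least-fixed : ∀ {b} (β : Aut P) → (∀ x → b ≤ᴾ x) → to β b ≡ b
  least-fixed {b} β least =
    ≤ᴾ-antisym (subst (to β b ≤ᴾ_) (to-from β b) (to-mono β (least (from β b)))) (least _)

  greatest-fixed : ∀ {t} (β : Aut P) → (∀ x → x ≤ᴾ t) → to β t ≡ t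
  greatest-fixed {t} β greatest =
    ≤ᴾ-antisym (greatest _) (subst (_≤ᴾ to β t) (to-from β t) (to-mono β (greatest (from β t))))

  flag-image : ∀ {Φ} (β : Aut P) → Flag Φ → Flag (λ u → Φ (from β u))
  flag-image {Φ} β (chain , maximal) = image-chain , image-maximal
    where
      image-chain : IsChain P (λ u → Φ (from β u))
      image-chain a b Φa Φb = reflect-comparable (_⁻¹ᴬ P β) (chain _ _ Φa Φb)
      image-maximal : (C' : Carrier → Set) → IsChain P C' → (∀ y → Φ (from β y) → C' y) →
                      ∀ y → C' y → Φ (from β y)
      image-maximal C' chain' sub y C'y =
        maximal (λ v → C' (to β v)) (λ a b Ca Cb → reflect-comparable β (chain' _ _ Ca Cb))
          (λ v Φv → sub (to β v) (subst Φ (sym (from-to β v)) Φv))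
          (from β y) (subst C' (sym (to-from β y)) C'y)

  rank-preserved : ∀ {x r} (β : Aut P) → RankIs P x r → RankIs P (to β x) r
  rank-preserved {x} β (Φ , flag , Φx , (f , f-inj , enum)) =
      (λ u → Φ (from β u)) , flag-image β flag , subst Φ (sym (from-to β x)) Φx
    , (λ k → to β (f k)) , (λ e → f-inj (to-injective β e)) , enum'
    where
      to-index : ∀ {u} → Φ (from β u) × u < to β x → ∃ λ k → to β (f k) ≡ u
      to-index {u} (Φu , u<xβ) =
        let (k , e) = ⇔.to (enum (from β u)) (Φu , subst (from β u <_) (from-to β x) (from-< β u<xβ))
        in k , trans (cong (to β) e) (to-from β u)
      from-index : ∀ {u} → (∃ λ k → to β (f k) ≡ u) → Φ (from β u) × u < to β x
      from-index (k , refl) =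
        let (Φfk , fk<x) = ⇔.from (enum (f k)) (k , refl)
        in subst Φ (sym (from-to β (f k))) Φfk , to-< β fk<x
      enum' : ∀ u → (Φ (from β u) × u < to β x) ⇔ ∃ λ k → to β (f k) ≡ u
      enum' u = mk⇔ to-index from-index

module Ranks (P : PosetR) (n : ℕ) (K : IsIncidenceComplex P n) where
  open PosetR P
  open Cardinality P
  open PosetFacts P
  open IsIncidenceComplex K

  Below Above : (Carrier → Set) → Carrier → Carrier → Set
  Below Ψ x u = Ψ u × u < x
  Above Ψ x u = Ψ u × x < u

  trichotomy : ∀ {Ψ u x} → Flag Ψ → Ψ u → Ψ x → (u < x) ⊎ ((u ≡ x) ⊎ (x < u))
  trichotomy {Ψ} {u} {x} flag Ψu Ψx with decide-equal (flag-size Ψ flag) Ψu Ψx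
  ... | yes u≡x = inj₂ (inj₁ u≡x)
  ... | no u≢x with proj₁ flag u x Ψu Ψx
  ...   | inj₁ u≤x = inj₁ (u≤x , u≢x)
  ...   | inj₂ x≤u = inj₂ (inj₂ (x≤u , λ e → u≢x (sym e)))

  decide-below : ∀ {Ψ u x} → Flag Ψ → Ψ u → Ψ x → Dec (u < x)
  decide-below flag Ψu Ψx with trichotomy flag Ψu Ψx
  ... | inj₁ u<x = yes u<x
  ... | inj₂ (inj₁ refl) = no <-irrefl
  ... | inj₂ (inj₂ x<u) = no (<-asym x<u)

  decide-above : ∀ {Ψ u x} → Flag Ψ → Ψ u → Ψ x → Dec (x < u)
  decide-above flag Ψu Ψx = decide-below flag Ψx Ψu

  Around : (Carrier → Set) → (Carrier → Set) → Carrier → Carrier → Set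
  Around Φ Ψ x u = Below Φ x u ⊎ ((u ≡ x) ⊎ Above Ψ x u)

  flag-around : ∀ {Ψ x} → Flag Ψ → Ψ x → ∀ u → Ψ u ⇔ Around Ψ Ψ x u
  flag-around {Ψ} {x} flag Ψx u = mk⇔ split merge
    where
      split : Ψ u → Around Ψ Ψ x u
      split Ψu with trichotomy flag Ψu Ψx
      ... | inj₁ u<x = inj₁ (Ψu , u<x)
      ... | inj₂ (inj₁ u≡x) = inj₂ (inj₁ u≡x)
      ... | inj₂ (inj₂ x<u) = inj₂ (inj₂ (Ψu , x<u))
      merge : Around Ψ Ψ x u → Ψ u
      merge (inj₁ (Ψu , _)) = Ψu
      merge (inj₂ (inj₁ refl)) = Ψx
      merge (inj₂ (inj₂ (Ψu , _))) = Ψu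

  flag-count : ∀ {Θ Φ Ψ x a b} → Flag Θ → (∀ u → Θ u ⇔ Around Φ Ψ x u) →
               Size (Below Φ x) a → Size (Above Ψ x) b → suc (suc n) ≡ a + suc b
  flag-count {Θ} {Φ} {Ψ} {x} flag split below above =
    size-unique (flag-size Θ flag)
      (size-cong (λ u → mk⇔ (⇔.from (split u)) (⇔.to (split u)))
        (size-disjoint-union below (size-disjoint-union (size-singleton x) above x-not-above)
                             below-not-rest))
    where
      x-not-above : ∀ u → u ≡ x → ¬ Above Ψ x u
      x-not-above u refl (_ , x<x) = <-irrefl x<x
      below-not-rest : ∀ u → Below Φ x u → ¬ ((u ≡ x) ⊎ Above Ψ x u)
      below-not-rest u (_ , u<u) (inj₁ refl) = <-irrefl u<u
      below-not-rest u (_ , u<x) (inj₂ (_ , x<u)) = <-asym u<x x<u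

  splice : ∀ {Φ Ψ x} → Flag Φ → Flag Ψ → Φ x → Ψ x →
           Σ (Carrier → Set) λ Θ → Flag Θ × (∀ u → Θ u ⇔ Around Φ Ψ x u)
  splice {Φ} {Ψ} {x} flagΦ flagΨ Φx Ψx = Θ , flagΘ , λ u → mk⇔ (split u) (merge u)
    where
      Joint : Carrier → Set
      Joint u = (Φ u × u ≤ᴾ x) ⊎ (Ψ u × x ≤ᴾ u)
      joint-chain : IsChain P Joint
      joint-chain u v (inj₁ (Φu , _)) (inj₁ (Φv , _)) = proj₁ flagΦ u v Φu Φv
      joint-chain u v (inj₁ (_ , u≤x)) (inj₂ (_ , x≤v)) = inj₁ (≤ᴾ-trans u≤x x≤v)
      joint-chain u v (inj₂ (_ , x≤u)) (inj₁ (_ , v≤x)) = inj₂ (≤ᴾ-trans v≤x x≤u)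
      joint-chain u v (inj₂ (Ψu , _)) (inj₂ (Ψv , _)) = proj₁ flagΨ u v Ψu Ψv
      extension : Σ (Carrier → Set) λ Θ → Flag Θ × (∀ u → Joint u → Θ u)
      extension = chain-in-flag Joint joint-chain
      Θ : Carrier → Set
      Θ = proj₁ extension
      flagΘ : Flag Θ
      flagΘ = proj₁ (proj₂ extension)
      contains : ∀ u → Joint u → Θ u
      contains = proj₂ (proj₂ extension)
      Θx : Θ x
      Θx = contains x (inj₁ (Φx , ≤ᴾ-refl))
      -- a face of Θ below x is comparable with all of Φ, hence lies in Φ; dually above
      lower-in-Φ : ∀ u → Θ u → u < x → Φ u
      lower-in-Φ u Θu (u≤x , _) = flag-maximal flagΦ u λ w Φw → case-w w Φw (proj₁ flagΦ w x Φw Φx)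
        where
          case-w : ∀ w → Φ w → Comparable P w x → Comparable P w u
          case-w w Φw (inj₁ w≤x) = proj₁ flagΘ w u (contains w (inj₁ (Φw , w≤x))) Θu
          case-w w Φw (inj₂ x≤w) = inj₂ (≤ᴾ-trans u≤x x≤w)
      upper-in-Ψ : ∀ u → Θ u → x < u → Ψ u
      upper-in-Ψ u Θu (x≤u , _) = flag-maximal flagΨ u λ w Ψw → case-w w Ψw (proj₁ flagΨ w x Ψw Ψx)
        where
          case-w : ∀ w → Ψ w → Comparable P w x → Comparable P w u
          case-w w Ψw (inj₁ w≤x) = inj₁ (≤ᴾ-trans w≤x x≤u)
          case-w w Ψw (inj₂ x≤w) = proj₁ flagΘ w u (contains w (inj₂ (Ψw , x≤w))) Θu
      split : ∀ u → Θ u → Around Φ Ψ x u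
      split u Θu with trichotomy flagΘ Θu Θx
      ... | inj₁ u<x = inj₁ (lower-in-Φ u Θu u<x , u<x)
      ... | inj₂ (inj₁ u≡x) = inj₂ (inj₁ u≡x)
      ... | inj₂ (inj₂ x<u) = inj₂ (inj₂ (upper-in-Ψ u Θu x<u , x<u))
      merge : ∀ u → Around Φ Ψ x u → Θ u
      merge u (inj₁ (Φu , u<x)) = contains u (inj₁ (Φu , proj₁ u<x))
      merge u (inj₂ (inj₁ refl)) = Θx
      merge u (inj₂ (inj₂ (Ψu , x<u))) = contains u (inj₂ (Ψu , proj₁ x<u))

  count-below : ∀ {Ψ x} → Flag Ψ → Ψ x → Σ ℕ λ m → Size (Below Ψ x) m
  count-below {Ψ} flag Ψx =
    size-filter _ (flag-size Ψ flag) (λ r → decide-below flag (element (flag-size Ψ flag) r) Ψx)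

  count-above : ∀ {Ψ x} → Flag Ψ → Ψ x → Σ ℕ λ m → Size (Above Ψ x) m
  count-above {Ψ} flag Ψx =
    size-filter _ (flag-size Ψ flag) (λ r → decide-above flag (element (flag-size Ψ flag) r) Ψx)

  -- The number of faces below x is the same in every flag through x: splicing the
  -- lower part of a flag Φ witnessing the rank of x onto Ψ keeps the upper count q.
  rank-in-flag : ∀ {Ψ x m r} → Flag Ψ → Ψ x → Size (Below Ψ x) m → RankIs P x r → m ≡ r
  rank-in-flag {Ψ} {x} {m} {r} flagΨ Ψx below-in-Ψ (Φ , flagΦ , Φx , below-in-Φ)
    with count-above flagΨ Ψx | splice flagΦ flagΨ Φx Ψx
  ... | q , above | Θ , flagΘ , Θ-around =
    ℕP.+-cancelʳ-≡ (suc q) m r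
      (trans (sym (flag-count flagΨ (flag-around flagΨ Ψx) below-in-Ψ above))
             (flag-count flagΘ Θ-around below-in-Φ above))

  rank-unique : ∀ {x r r'} → RankIs P x r → RankIs P x r' → r ≡ r'
  rank-unique (Φ , flagΦ , Φx , below) = rank-in-flag flagΦ Φx below

  comparable-pair : ∀ {x y} → x ≤ᴾ y → IsChain P (λ u → u ≡ x ⊎ u ≡ y)
  comparable-pair x≤y _ _ (inj₁ refl) (inj₁ refl) = inj₁ ≤ᴾ-refl
  comparable-pair x≤y _ _ (inj₁ refl) (inj₂ refl) = inj₁ x≤y
  comparable-pair x≤y _ _ (inj₂ refl) (inj₁ refl) = inj₂ x≤y
  comparable-pair x≤y _ _ (inj₂ refl) (inj₂ refl) = inj₁ ≤ᴾ-refl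

  flag-through : ∀ {x y} → x ≤ᴾ y → Σ (Carrier → Set) λ Ψ → Flag Ψ × Ψ x × Ψ y
  flag-through {x} {y} x≤y with chain-in-flag _ (comparable-pair x≤y)
  ... | Ψ , flag , contains = Ψ , flag , contains x (inj₁ refl) , contains y (inj₂ refl)

  -- On a flag through x < y, the faces below x together with x inject into the faces below y.
  below-count-increasing : ∀ {Ψ x y m m'} → Ψ x → x < y →
                           Size (Below Ψ x) m → Size (Below Ψ y) m' → m <ℕ m'
  below-count-increasing {Ψ} {x} {y} {m} {m'} Ψx x<y below-x below-y =
    subst (_≤ m') (ℕP.+-comm m 1)
      (injection-bound below-y (proj₁ up-to-x) (proj₁ (proj₂ up-to-x)) (λ r → into-below-y (element up-to-x r)))
    where
      up-to-x : Size (λ u → Below Ψ x u ⊎ u ≡ x) (m + 1)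
      up-to-x = size-disjoint-union below-x (size-singleton x) (λ { u (_ , u<u) refl → <-irrefl u<u })
      into-below-y : ∀ {u} → Below Ψ x u ⊎ u ≡ x → Below Ψ y u
      into-below-y (inj₁ (Ψu , u<x)) = Ψu , <-trans u<x x<y
      into-below-y (inj₂ refl) = Ψx , x<y

  rank-increasing : ∀ {x y a b} → x < y → RankIs P x a → RankIs P y b → a <ℕ b
  rank-increasing x<y rank-x rank-y with flag-through (proj₁ x<y)
  ... | Ψ , flag , Ψx , Ψy with count-below flag Ψx | count-below flag Ψy
  ...   | m , below-x | m' , below-y =
    subst₂ _<ℕ_ (rank-in-flag flag Ψx below-x rank-x) (rank-in-flag flag Ψy below-y rank-y)
      (below-count-increasing Ψx x<y below-x below-y)

module Generated (P : PosetR) where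

  gen-mono : ∀ {S S' : Aut P → Set} → (∀ φ → S φ → S' φ) → ∀ {φ} → Gen P S φ → Gen P S' φ
  gen-mono f (gen s) = gen (f _ s)
  gen-mono f gid = gid
  gen-mono f (gcomp g h) = gcomp (gen-mono f g) (gen-mono f h)
  gen-mono f (ginv g) = ginv (gen-mono f g)
  gen-mono f (gresp e g) = gresp e (gen-mono f g)

  gen-fixes : ∀ {S : Aut P → Set} {x} → (∀ φ → S φ → to φ x ≡ x) → ∀ {φ} → Gen P S φ → to φ x ≡ x
  gen-fixes f (gen s) = f _ s
  gen-fixes f gid = refl
  gen-fixes f (gcomp {φ} {ψ} g h) = trans (cong (to ψ) (gen-fixes f g)) (gen-fixes f h)
  gen-fixes {x = x} f (ginv {φ} g) = trans (cong (from φ) (sym (gen-fixes f g))) (from-to φ x)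
  gen-fixes {x = x} f (gresp {φ} {ψ} e g) = trans (sym (e x)) (gen-fixes f g)

  gen-within : ∀ {S Γ : Aut P → Set} → IsSubgroup P Γ → (∀ φ → S φ → Γ φ) → ∀ {φ} → Gen P S φ → Γ φ
  gen-within sg f (gen s) = f _ s
  gen-within sg f gid = IsSubgroup.id∈ sg
  gen-within sg f (gcomp g h) = IsSubgroup.∘∈ sg (gen-within sg f g) (gen-within sg f h)
  gen-within sg f (ginv g) = IsSubgroup.⁻¹∈ sg (gen-within sg f g)
  gen-within sg f (gresp e g) = IsSubgroup.resp sg e (gen-within sg f g)

no-room : ∀ {a b} → a <ℕ b → ¬ (b ≤ a + 0)
no-room {a} a<b b≤a = ℕP.<⇒≱ a<b (subst (_ ≤_) (ℕP.+-identityʳ a) b≤a)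

shrink-from-left : ∀ {a s b d} → a <ℕ s → b ≤ a + suc d → b ≤ s + d
shrink-from-left {a} {s} {b} {d} a<s b≤ =
  ℕP.≤-trans b≤ (subst (_≤ s + d) (sym (ℕP.+-suc a d)) (ℕP.+-monoˡ-≤ d a<s))

shrink-from-right : ∀ {a s b d} → s <ℕ b → b ≤ a + suc d → s ≤ a + d
shrink-from-right {a} {s} {b} {d} s<b b≤ =
  ℕP.≤-pred (ℕP.≤-trans s<b (subst (b ≤_) (ℕP.+-suc a d) b≤))

squeeze : ∀ {a l b} → a <ℕ l → l <ℕ b → b ≤ 2 + a → l ≡ suc a
squeeze a<l l<b b≤ = ℕP.≤-antisym (ℕP.≤-pred (ℕP.≤-trans l<b b≤)) a<l

wide-gap : ∀ {a b} → ¬ (b ≤ 2 + a) → a + 3 ≤ b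
wide-gap {a} {b} b≰ = subst (_≤ b) (ℕP.+-comm 3 a) (ℕP.≰⇒> b≰)

module CosetGeometry (P : PosetR) (n : ℕ) (K : IsIncidenceComplex P n)
                     (Γ : Aut P → Set) (sg : IsSubgroup P Γ) (ft : FlagTransitive P Γ)
                     (F : Fin (suc (suc n)) → PosetR.Carrier P) (bf : IsBaseFlag P n F) where
  open PosetR P
  open PosetFacts P
  open Ranks P n K
  open Generated P
  open IsIncidenceComplex K using (least; greatest; chain-in-flag; connected)
  module SG = IsSubgroup sg

  Idx : Set
  Idx = Fin (suc (suc n))

  BaseFace : Carrier → Set
  BaseFace u = ∃ λ r → F r ≡ u

  base-flag : Flag BaseFace
  base-flag = proj₁ bf

  base-rank : ∀ r → RankIs P (F r) (toℕ r)
  base-rank = proj₂ bf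

  base-comparable : ∀ k l → Comparable P (F k) (F l)
  base-comparable k l = proj₁ base-flag (F k) (F l) (k , refl) (l , refl)

  F-injective : ∀ {k l} → F k ≡ F l → k ≡ l
  F-injective {k} {l} e =
    FinP.toℕ-injective (rank-unique (base-rank k) (subst (λ z → RankIs P z (toℕ l)) (sym e) (base-rank l)))

  F-reflects-< : ∀ {k l} → F k < F l → toℕ k <ℕ toℕ l
  F-reflects-< Fk<Fl = rank-increasing Fk<Fl (base-rank _) (base-rank _)

  F-monotone : ∀ {k l} → toℕ k ≤ toℕ l → F k ≤ᴾ F l
  F-monotone {k} {l} k≤l with base-comparable k l | k FinP.≟ l
  ... | inj₁ Fk≤Fl | _ = Fk≤Fl
  ... | inj₂ _ | yes refl = ≤ᴾ-refl
  ... | inj₂ Fl≤Fk | no k≢l =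
    ⊥-elim (ℕP.<⇒≱ (F-reflects-< (Fl≤Fk , λ e → k≢l (F-injective (sym e)))) k≤l)

  F-strict : ∀ {k l} → toℕ k <ℕ toℕ l → F k < F l
  F-strict k<l = F-monotone (ℕP.<⇒≤ k<l) , λ e → ℕP.<⇒≢ k<l (cong toℕ (F-injective e))

  top : Idx
  top = fromℕ (suc n)

  toℕ-top : toℕ top ≡ suc n
  toℕ-top = FinP.toℕ-fromℕ (suc n)

  at-top : ∀ {k} → toℕ top ≤ toℕ k → k ≡ top
  at-top {k} top≤k =
    FinP.toℕ-injective (ℕP.≤-antisym (subst (toℕ k ≤_) (sym toℕ-top) (FinP.toℕ≤pred[n] k)) top≤k)

  below-top : ∀ l → l ≢ top → toℕ l ≤ n
  below-top l l≢top with ℕP.m≤n⇒m<n∨m≡n (FinP.toℕ≤pred[n] l)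
  ... | inj₁ l<top = ℕP.≤-pred l<top
  ... | inj₂ l≡top = ⊥-elim (l≢top (FinP.toℕ-injective (trans l≡top (sym toℕ-top))))

  -- The extreme base faces are the least and greatest faces of K: the least face
  -- b is comparable with everything, so b = F r by maximality, and F 0 ≤ F r.
  bottom-least : ∀ x → F fzero ≤ᴾ x
  bottom-least x with least
  ... | b , b≤ with flag-maximal base-flag b (λ w _ → inj₂ (b≤ w))
  ...   | r , refl = ≤ᴾ-trans (F-monotone z≤n) (b≤ x)

  top-greatest : ∀ x → x ≤ᴾ F top
  top-greatest x with greatest
  ... | t , ≤t with flag-maximal base-flag t (λ w _ → inj₁ (≤t w))
  ...   | r , refl = ≤ᴾ-trans (≤t x) (F-monotone (subst (toℕ r ≤_) (sym toℕ-top) (FinP.toℕ≤pred[n] r)))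

  index-by-rank : ∀ (β : Aut P) {u s k} → RankIs P u (toℕ k) → u ≡ to β (F s) → s ≡ k
  index-by-rank β {s = s} rank-u refl = FinP.toℕ-injective (rank-unique (rank-preserved β (base-rank s)) rank-u)

  Places : (Carrier → Set) → Aut P → Set₁
  Places C₀ β = (∀ u → C₀ u → ∃ λ s → u ≡ to β (F s))
              × (∀ u k → C₀ u → RankIs P u (toℕ k) → u ≡ to β (F k))

  -- Flag transitivity: extend a chain to a flag and carry the base flag onto it.
  move-chain-to-base : (C₀ : Carrier → Set) → IsChain P C₀ → Σ (Aut P) λ β → Γ β × Places C₀ β
  move-chain-to-base C₀ chain with chain-in-flag C₀ chain
  ... | Ψ , flagΨ , contains with ft BaseFace Ψ base-flag flagΨ
  ...   | β , Γβ , maps = β , Γβ , position , placed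
    where
      position : ∀ u → C₀ u → ∃ λ s → u ≡ to β (F s)
      position u C₀u with ⇔.from (maps (from β u)) (subst Ψ (sym (to-from β u)) (contains u C₀u))
      ... | s , Fs≡ = s , trans (sym (to-from β u)) (cong (to β) (sym Fs≡))
      placed : ∀ u k → C₀ u → RankIs P u (toℕ k) → u ≡ to β (F k)
      placed u k C₀u rank-u with position u C₀u
      ... | s , u≡ = trans u≡ (cong (λ z → to β (F z)) (index-by-rank β rank-u u≡))

  -- Γ⟨a,b⟩: the subgroup generated by the R_k with a < k < b; it acts on the
  -- section F_b/F_a and fixes the base faces outside (a,b).
  Between Outside : Idx → Idx → Idx → Set
  Between a b k = toℕ a <ℕ toℕ k × toℕ k <ℕ toℕ b
  Outside a b k = toℕ k ≤ toℕ a ⊎ toℕ b ≤ toℕ k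

  between-or-outside : ∀ a b k → Between a b k ⊎ Outside a b k
  between-or-outside a b k with toℕ k ℕP.≤? toℕ a | toℕ b ℕP.≤? toℕ k
  ... | yes k≤a | _ = inj₂ (inj₁ k≤a)
  ... | no _ | yes b≤k = inj₂ (inj₂ b≤k)
  ... | no k≰a | no b≰k = inj₁ (ℕP.≰⇒> k≰a , ℕP.≰⇒> b≰k)

  not-between-and-outside : ∀ {a b k} → Between a b k → ¬ Outside a b k
  not-between-and-outside (a<k , _) (inj₁ k≤a) = ℕP.<⇒≱ a<k k≤a
  not-between-and-outside (_ , k<b) (inj₂ b≤k) = ℕP.<⇒≱ k<b b≤k

  Γ⟨_,_⟩ : Idx → Idx → Aut P → Set
  Γ⟨ a , b ⟩ = Gen P (λ φ → ∃ λ k → Between a b k × R P Γ F k φ)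

  Stabilises : Idx → Idx → Aut P → Set
  Stabilises a b γ = ∀ k → Outside a b k → to γ (F k) ≡ F k

  interval-stabilises : ∀ {a b δ} → Γ⟨ a , b ⟩ δ → Stabilises a b δ
  interval-stabilises g k out = gen-fixes
    (λ { φ (k' , between , (_ , fixes)) → fixes k λ { refl → not-between-and-outside between out } }) g

  interval-in-Γ : ∀ {a b δ} → Γ⟨ a , b ⟩ δ → Γ δ
  interval-in-Γ = gen-within sg (λ { φ (_ , _ , (Γφ , _)) → Γφ })

  interval-mono : ∀ {a b a' b' δ} → toℕ a ≤ toℕ a' → toℕ b' ≤ toℕ b → Γ⟨ a' , b' ⟩ δ → Γ⟨ a , b ⟩ δ
  interval-mono a≤a' b'≤b = gen-mono
    λ { φ (k , (a'<k , k<b') , r) → k , (ℕP.≤-<-trans a≤a' a'<k , ℕP.<-≤-trans k<b' b'≤b) , r }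

  -- In a section of rank one only one base face, F s, is not fixed; so an element
  -- of Γ fixing the others is a generator R_s.
  narrow-generator : ∀ {a b s γ} → toℕ b ≤ 2 + toℕ a → Between a b s → Γ γ → Stabilises a b γ →
                     Γ⟨ a , b ⟩ γ
  narrow-generator {a} {b} {s} {γ} narrow s-between Γγ fixes = gen (s , s-between , Γγ , fixes-others)
    where
      fixes-others : ∀ l → l ≢ s → to γ (F l) ≡ F l
      fixes-others l l≢s with between-or-outside a b l
      ... | inj₂ out = fixes l out
      ... | inj₁ (a<l , l<b) = ⊥-elim (l≢s (FinP.toℕ-injective
              (trans (squeeze a<l l<b narrow) (sym (squeeze (proj₁ s-between) (proj₂ s-between) narrow)))))

  InOrbit : Idx → Idx → Carrier → Set
  InOrbit a b y = ∃ λ s → ∃ λ δ → Γ⟨ a , b ⟩ δ × y ≡ to δ (F s)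

  InSection : Idx → Idx → Carrier → Set
  InSection a b y = F a < y × y < F b

  OrbitClaim : ℕ → Set
  OrbitClaim d = ∀ a b → toℕ a <ℕ toℕ b → toℕ b ≤ toℕ a + d →
                 ∀ y → F a ≤ᴾ y → y ≤ᴾ F b → InOrbit a b y

  OutsideAnd : Idx → Idx → Carrier → Carrier → Set
  OutsideAnd a b y u = (∃ λ k → Outside a b k × F k ≡ u) ⊎ u ≡ y

  outside-and-chain : ∀ {a b y} → F a ≤ᴾ y → y ≤ᴾ F b → IsChain P (OutsideAnd a b y)
  outside-and-chain {a} {b} {y} a≤y y≤b = chain
    where
      outside-vs-y : ∀ k → Outside a b k → Comparable P (F k) y
      outside-vs-y k (inj₁ k≤a) = inj₁ (≤ᴾ-trans (F-monotone k≤a) a≤y)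
      outside-vs-y k (inj₂ b≤k) = inj₂ (≤ᴾ-trans y≤b (F-monotone b≤k))
      chain : IsChain P (OutsideAnd a b y)
      chain _ _ (inj₁ (k , _ , refl)) (inj₁ (l , _ , refl)) = base-comparable k l
      chain _ _ (inj₁ (k , out , refl)) (inj₂ refl) = outside-vs-y k out
      chain _ _ (inj₂ refl) (inj₁ (k , out , refl)) with outside-vs-y k out
      ... | inj₁ Fk≤y = inj₂ Fk≤y
      ... | inj₂ y≤Fk = inj₁ y≤Fk
      chain _ _ (inj₂ refl) (inj₂ refl) = inj₁ ≤ᴾ-refl

  position-in-section : ∀ {a b y} → F a ≤ᴾ y → y ≤ᴾ F b →
    ∃ λ s → ∃ λ β → Γ β × Stabilises a b β × y ≡ to β (F s)
  position-in-section {a} {b} {y} a≤y y≤b with move-chain-to-base _ (outside-and-chain a≤y y≤b)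
  ... | β , Γβ , position , placed with position y (inj₂ refl)
  ...   | s , y≡ = s , β , Γβ , (λ k out → sym (placed (F k) k (inj₁ (k , out , refl)) (base-rank k))) , y≡

  orbit-lift : ∀ {a b a' b' δ u} → toℕ a ≤ toℕ a' → toℕ b' ≤ toℕ b → Γ⟨ a , b ⟩ δ →
               InOrbit a' b' u → InOrbit a b (to δ u)
  orbit-lift {δ = δ} a≤a' b'≤b gδ (s , δ' , gδ' , u≡) =
    s , _∘ᴬ_ P δ' δ , gcomp (interval-mono a≤a' b'≤b gδ') gδ , cong (to δ) u≡

  -- One step along a path of the section: if x = F_s δ is in the orbit and y is
  -- comparable with x, then y δ⁻¹ lies in F_b/F_s or in F_s/F_a, sections of
  -- smaller width, where the induction hypothesis applies.
  orbit-step : ∀ {d a b x y} → OrbitClaim d → toℕ b ≤ toℕ a + suc d → Comparable P x y →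
               InSection a b x → InSection a b y → InOrbit a b x → InOrbit a b y
  orbit-step {d} {a} {b} {x} {y} claim width x~y (a<x , x<b) (a<y , y<b) (s , δ , gδ , x≡) =
    subst (InOrbit a b) (to-from δ y) pulled-back
    where
      a-fixed : from δ (F a) ≡ F a
      a-fixed = from-fixed δ (interval-stabilises gδ a (inj₁ ℕP.≤-refl))
      b-fixed : from δ (F b) ≡ F b
      b-fixed = from-fixed δ (interval-stabilises gδ b (inj₂ ℕP.≤-refl))
      x-back : from δ x ≡ F s
      x-back = trans (cong (from δ) x≡) (from-to δ (F s))
      a<s : toℕ a <ℕ toℕ s
      a<s = F-reflects-< (subst₂ _<_ a-fixed x-back (from-< δ a<x))
      s<b : toℕ s <ℕ toℕ b
      s<b = F-reflects-< (subst₂ _<_ x-back b-fixed (from-< δ x<b))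
      u : Carrier
      u = from δ y
      a≤u : F a ≤ᴾ u
      a≤u = subst (_≤ᴾ u) a-fixed (from-mono δ (proj₁ a<y))
      u≤b : u ≤ᴾ F b
      u≤b = subst (u ≤ᴾ_) b-fixed (from-mono δ (proj₁ y<b))
      pulled-back : InOrbit a b (to δ u)
      pulled-back with subst (λ z → Comparable P z u) x-back (preserve-comparable (_⁻¹ᴬ P δ) x~y)
      ... | inj₁ s≤u = orbit-lift (ℕP.<⇒≤ a<s) ℕP.≤-refl gδ
                         (claim s b s<b (shrink-from-left a<s width) u s≤u u≤b)
      ... | inj₂ u≤s = orbit-lift ℕP.≤-refl (ℕP.<⇒≤ s<b) gδ
                         (claim a s a<s (shrink-from-right s<b width) u a≤u u≤s)

  orbit-along-path : ∀ {d a b x z} → OrbitClaim d → toℕ b ≤ toℕ a + suc d →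
                     PathIn P (InSection a b) x z → InSection a b x → InOrbit a b x → InOrbit a b z
  orbit-along-path claim width here _ x-orbit = x-orbit
  orbit-along-path claim width (step x~y y-in path) x-in x-orbit =
    orbit-along-path claim width path y-in (orbit-step claim width x~y x-in y-in x-orbit)

  -- Place y by flag transitivity; if it sits at F_s with a < s < b, then either the
  -- section has rank one and the placing element is a generator, or the section is
  -- connected (I3) and y is reached from F_s by a path of proper faces.
  orbit : ∀ d → OrbitClaim d
  orbit zero a b a<b width = ⊥-elim (no-room a<b width)
  orbit (suc d) a b a<b width y a≤y y≤b with position-in-section a≤y y≤b
  ... | s , β , Γβ , fixes , y≡ with between-or-outside a b s
  ...   | inj₂ out = s , idᴬ P , gid , trans y≡ (fixes s out)
  ...   | inj₁ (a<s , s<b) with toℕ b ℕP.≤? 2 + toℕ a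
  ...     | yes narrow = s , β , narrow-generator narrow (a<s , s<b) Γβ fixes , y≡
  ...     | no wide = orbit-along-path (orbit d) width path s-in (s , idᴬ P , gid , refl)
    where
      s-in : InSection a b (F s)
      s-in = F-strict a<s , F-strict s<b
      y-in : InSection a b y
      y-in = subst₂ _<_ (fixes a (inj₁ ℕP.≤-refl)) (sym y≡) (to-< β (F-strict a<s))
           , subst₂ _<_ (sym y≡) (fixes b (inj₂ ℕP.≤-refl)) (to-< β (F-strict s<b))
      path : PathIn P (InSection a b) (F s) y
      path = connected (F a) (F b) (toℕ a) (toℕ b) (F-monotone (ℕP.<⇒≤ a<b))
               (base-rank a) (base-rank b) (wide-gap wide) (F s) y s-in y-in

  next-index : ∀ {a b : Idx} → suc (toℕ a) <ℕ toℕ b → Idx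
  next-index {b = b} a+1<b = fromℕ< (ℕP.<-trans a+1<b (FinP.toℕ<n b))

  toℕ-next-index : ∀ {a b : Idx} (a+1<b : suc (toℕ a) <ℕ toℕ b) → toℕ (next-index a+1<b) ≡ suc (toℕ a)
  toℕ-next-index {b = b} a+1<b = FinP.toℕ-fromℕ< (ℕP.<-trans a+1<b (FinP.toℕ<n b))

  -- An element γ fixing the base faces outside (a,b) agrees on F_{a+1} with some
  -- δ ∈ Γ⟨a,b⟩ (orbit lemma), so γδ⁻¹ fixes the base faces outside (a+1,b).
  peel-lowest : ∀ {a a₁ b γ} → toℕ a₁ ≡ suc (toℕ a) → toℕ a₁ <ℕ toℕ b → Stabilises a b γ →
                ∃ λ δ → Γ⟨ a , b ⟩ δ × Stabilises a₁ b (_∘ᴬ_ P γ (_⁻¹ᴬ P δ))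
  peel-lowest {a} {a₁} {b} {γ} a₁≡ a₁<b fixes = δ , gδ , fixes'
    where
      a<a₁ : toℕ a <ℕ toℕ a₁
      a<a₁ = subst (toℕ a <ℕ_) (sym a₁≡) (ℕP.n<1+n _)
      y : Carrier
      y = to γ (F a₁)
      image : InOrbit a b y
      image = orbit (toℕ b) a b (ℕP.<-trans a<a₁ a₁<b) (ℕP.m≤n+m (toℕ b) (toℕ a)) y
                (subst (_≤ᴾ y) (fixes a (inj₁ ℕP.≤-refl)) (to-mono γ (F-monotone (ℕP.<⇒≤ a<a₁))))
                (subst (y ≤ᴾ_) (fixes b (inj₂ ℕP.≤-refl)) (to-mono γ (F-monotone (ℕP.<⇒≤ a₁<b))))
      s : Idx
      s = proj₁ image
      δ : Aut P
      δ = proj₁ (proj₂ image)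
      gδ : Γ⟨ a , b ⟩ δ
      gδ = proj₁ (proj₂ (proj₂ image))
      y≡ : y ≡ to δ (F s)
      y≡ = proj₂ (proj₂ (proj₂ image))
      fixes-outside : ∀ k → Outside a b k → from δ (to γ (F k)) ≡ F k
      fixes-outside k out = trans (cong (from δ) (fixes k out)) (from-fixed δ (interval-stabilises gδ k out))
      fixes-a₁ : from δ (to γ (F a₁)) ≡ F a₁
      fixes-a₁ = begin
        from δ y            ≡⟨ cong (from δ) y≡ ⟩
        from δ (to δ (F s)) ≡⟨ from-to δ (F s) ⟩
        F s                 ≡⟨ cong F (index-by-rank δ (rank-preserved γ (base-rank a₁)) y≡) ⟩
        F a₁                ∎
        where open ≡-Reasoning
      fixes' : Stabilises a₁ b (_∘ᴬ_ P γ (_⁻¹ᴬ P δ))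
      fixes' k (inj₂ b≤k) = fixes-outside k (inj₂ b≤k)
      fixes' k (inj₁ k≤a₁) with ℕP.m≤n⇒m<n∨m≡n k≤a₁
      ... | inj₁ k<a₁ = fixes-outside k (inj₁ (ℕP.≤-pred (subst (toℕ k <ℕ_) a₁≡ k<a₁)))
      ... | inj₂ k≡a₁ with FinP.toℕ-injective k≡a₁
      ...   | refl = fixes-a₁

  -- Stabiliser lemma, by induction on w = b − a − 2: an element of Γ fixing the base
  -- faces outside (a,b) is the generator R_{a+1} when w = 0; otherwise peel off
  -- F_{a+1} and recurse on (a+1,b).
  stabiliser-by-width : ∀ w {a b γ} → toℕ b ≡ suc (suc w) + toℕ a → Γ γ → Stabilises a b γ →
                        Γ⟨ a , b ⟩ γ
  stabiliser-by-width zero {a} {b} b≡ Γγ fixes =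
    narrow-generator (ℕP.≤-reflexive b≡)
      (subst (toℕ a <ℕ_) (sym (toℕ-next-index a+1<b)) (ℕP.n<1+n _) ,
       subst (_<ℕ toℕ b) (sym (toℕ-next-index a+1<b)) a+1<b) Γγ fixes
    where
      a+1<b : suc (toℕ a) <ℕ toℕ b
      a+1<b = subst (suc (toℕ a) <ℕ_) (sym b≡) (ℕP.n<1+n _)
  stabiliser-by-width (suc w) {a} {b} {γ} b≡ Γγ fixes =
    gresp (λ x → to-from δ (to γ x)) (gcomp (interval-mono a≤a₁ ℕP.≤-refl γ'-in) gδ)
    where
      a+1<b : suc (toℕ a) <ℕ toℕ b
      a+1<b = subst (suc (toℕ a) <ℕ_) (sym b≡) (s≤s (s≤s (ℕP.m≤n⇒m≤1+n (ℕP.m≤n+m (toℕ a) w))))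
      a₁ : Idx
      a₁ = next-index a+1<b
      a₁≡ : toℕ a₁ ≡ suc (toℕ a)
      a₁≡ = toℕ-next-index a+1<b
      a≤a₁ : toℕ a ≤ toℕ a₁
      a≤a₁ = subst (toℕ a ≤_) (sym a₁≡) (ℕP.n≤1+n _)
      peeled : ∃ λ δ → Γ⟨ a , b ⟩ δ × Stabilises a₁ b (_∘ᴬ_ P γ (_⁻¹ᴬ P δ))
      peeled = peel-lowest {γ = γ} a₁≡ (subst (_<ℕ toℕ b) (sym a₁≡) a+1<b) fixes
      δ : Aut P
      δ = proj₁ peeled
      gδ : Γ⟨ a , b ⟩ δ
      gδ = proj₁ (proj₂ peeled)
      b≡' : toℕ b ≡ suc (suc w) + toℕ a₁
      b≡' = trans b≡ (cong (λ z → suc (suc z))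
              (sym (trans (cong (w +_) a₁≡) (ℕP.+-suc w (toℕ a)))))
      γ'-in : Γ⟨ a₁ , b ⟩ (_∘ᴬ_ P γ (_⁻¹ᴬ P δ))
      γ'-in = stabiliser-by-width w b≡' (SG.∘∈ Γγ (SG.⁻¹∈ (interval-in-Γ gδ))) (proj₂ (proj₂ peeled))

  stabiliser : ∀ {a b γ} → suc (toℕ a) <ℕ toℕ b → Γ γ → Stabilises a b γ → Γ⟨ a , b ⟩ γ
  stabiliser {a} a+1<b with ℕP.m≤n⇒∃[o]m+o≡n a+1<b
  ... | w , e = stabiliser-by-width w (trans (sym e) (cong (λ z → suc (suc z)) (ℕP.+-comm (toℕ a) w)))

  -- The face F_i of rank i has index i + 1.
  ix : Fin n → Idx
  ix i = fsuc (inject₁ i)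

  toℕ-ix : ∀ i → toℕ (ix i) ≡ suc (toℕ i)
  toℕ-ix i = cong suc (FinP.toℕ-inject₁ i)

  ix-monotone : ∀ {i j} → toℕ i ≤ toℕ j → toℕ (ix i) ≤ toℕ (ix j)
  ix-monotone {i} {j} i≤j = subst₂ _≤_ (sym (toℕ-ix i)) (sym (toℕ-ix j)) (s≤s i≤j)

  -- F_i is moved neither by Γ⁺_{i+1} nor by Γ⁻_{i−1}.
  ix-not-upper : ∀ i → ¬ (suc (suc (toℕ i)) ≤ toℕ (ix i))
  ix-not-upper i le = ℕP.1+n≰n (subst (suc (suc (toℕ i)) ≤_) (toℕ-ix i) le)

  ix-not-lower : ∀ j → ¬ (toℕ (ix j) ≤ toℕ j)
  ix-not-lower j le = ℕP.1+n≰n (subst (_≤ toℕ j) (toℕ-ix j) le)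

  -- Γ_I fixes every base face F_l with l ∉ I (l ≠ −1, as Γ_∅ = R_{−1}).
  ΓI-fixes : ∀ {I : Idx → Set} {φ} l → ¬ I l → l ≢ fzero → ΓI P Γ F I φ → to φ (F l) ≡ F l
  ΓI-fixes l l∉I l≢0 = gen-fixes λ
    { φ (inj₁ (k , k∈I , (_ , fixes))) → fixes l (λ { refl → l∉I k∈I })
    ; φ (inj₂ (_ , (_ , fixes))) → fixes l l≢0 }

  ΓI-mono : ∀ {I I' : Idx → Set} {φ} → (∀ k → I k → I' k) → I' fzero → ΓI P Γ F I φ → ΓI P Γ F I' φ
  ΓI-mono I⊆I' 0∈I' = gen-mono λ
    { φ (inj₁ (k , k∈I , r)) → inj₁ (k , I⊆I' k k∈I , r)
    ; φ (inj₂ (_ , r)) → inj₁ (fzero , 0∈I' , r) }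

  interval-in-ΓI : ∀ {I : Idx → Set} {a b φ} → (∀ k → Between a b k → I k) → Γ⟨ a , b ⟩ φ → ΓI P Γ F I φ
  interval-in-ΓI I⊇ = gen-mono λ { φ (k , between , r) → inj₁ (k , I⊇ k between , r) }

  lower-stabiliser : ∀ j {β} → Γ β → (∀ k → toℕ (ix j) ≤ toℕ k → to β (F k) ≡ F k) → Γ⁻-pred P Γ F j β
  lower-stabiliser j {β} Γβ fixes with 1 ℕP.<? toℕ (ix j)
  ... | yes 1<J = interval-in-ΓI (λ k (_ , k<J) → ℕP.≤-pred (subst (toℕ k <ℕ_) (toℕ-ix j) k<J))
                                 (stabiliser 1<J Γβ outside)
    where
      outside : Stabilises fzero (ix j) β
      outside k (inj₁ k≤0) with FinP.toℕ-injective {i = k} {j = fzero} (ℕP.n≤0⇒n≡0 k≤0)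
      ... | refl = least-fixed β bottom-least
      outside k (inj₂ J≤k) = fixes k J≤k
  ... | no 1≮J = gen (inj₁ (fzero , z≤n , Γβ , λ l l≢0 → fixes l (ℕP.≤-trans (ℕP.≮⇒≥ 1≮J) (positive l l≢0))))
    where
      positive : ∀ l → l ≢ fzero → 1 ≤ toℕ l
      positive l l≢0 = ℕP.≤∧≢⇒< z≤n (λ e → l≢0 (FinP.toℕ-injective (sym e)))

  upper-stabiliser : ∀ i {α} → Γ α → (∀ k → toℕ k ≤ toℕ (ix i) → to α (F k) ≡ F k) → Γ⁺-succ P Γ F i α
  upper-stabiliser i {α} Γα fixes with suc (toℕ (ix i)) ℕP.<? toℕ top
  ... | yes I+1<top = interval-in-ΓI (λ k (I<k , _) → subst (_<ℕ toℕ k) (toℕ-ix i) I<k)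
                                     (stabiliser I+1<top Γα outside)
    where
      outside : Stabilises (ix i) top α
      outside k (inj₁ k≤I) = fixes k k≤I
      outside k (inj₂ top≤k) with at-top top≤k
      ... | refl = greatest-fixed α top-greatest
  ... | no I+1≮top = gen (inj₁ (top , top-in , Γα , λ l l≢top → fixes l (ℕP.≤-trans (below-top l l≢top) n≤I)))
    where
      top-in : suc (suc (toℕ i)) ≤ toℕ top
      top-in = subst (suc (suc (toℕ i)) ≤_) (sym toℕ-top) (s≤s (FinP.toℕ<n i))
      n≤I : n ≤ toℕ (ix i)
      n≤I = ℕP.≤-pred (subst (_≤ suc (toℕ (ix i))) toℕ-top (ℕP.≮⇒≥ I+1≮top))

  LowerImageAndUpper : Aut P → Idx → Idx → Carrier → Set
  LowerImageAndUpper γ I J u = (∃ λ k → toℕ k ≤ toℕ I × to γ (F k) ≡ u) ⊎ (∃ λ k → toℕ J ≤ toℕ k × F k ≡ u)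

  lower-image-and-upper-chain : ∀ {γ I J} → to γ (F I) ≤ᴾ F J → IsChain P (LowerImageAndUpper γ I J)
  lower-image-and-upper-chain {γ} {I} {J} I≤J = chain
    where
      lower≤upper : ∀ {k l} → toℕ k ≤ toℕ I → toℕ J ≤ toℕ l → to γ (F k) ≤ᴾ F l
      lower≤upper k≤I J≤l = ≤ᴾ-trans (to-mono γ (F-monotone k≤I)) (≤ᴾ-trans I≤J (F-monotone J≤l))
      chain : IsChain P (LowerImageAndUpper γ I J)
      chain _ _ (inj₁ (k , _ , refl)) (inj₁ (l , _ , refl)) = preserve-comparable γ (base-comparable k l)
      chain _ _ (inj₁ (k , k≤I , refl)) (inj₂ (l , J≤l , refl)) = inj₁ (lower≤upper k≤I J≤l)
      chain _ _ (inj₂ (l , J≤l , refl)) (inj₁ (k , k≤I , refl)) = inj₂ (lower≤upper k≤I J≤l)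
      chain _ _ (inj₂ (k , _ , refl)) (inj₂ (l , _ , refl)) = base-comparable k l

  factor-at-incidence : ∀ {γ I J} → to γ (F I) ≤ᴾ F J →
    ∃ λ β → Γ β × (∀ k → toℕ J ≤ toℕ k → to β (F k) ≡ F k)
              × (∀ k → toℕ k ≤ toℕ I → to γ (F k) ≡ to β (F k))
  factor-at-incidence {γ} I≤J with move-chain-to-base _ (lower-image-and-upper-chain {γ} I≤J)
  ... | β , Γβ , _ , placed =
    β , Γβ , (λ k J≤k → sym (placed (F k) k (inj₂ (k , J≤k , refl)) (base-rank k)))
      , (λ k k≤I → placed _ k (inj₁ (k , k≤I , refl)) (rank-preserved γ (base-rank k)))

  Incident Factorisation CosetsMeet : Fin n → Fin n → Aut P → Aut P → Set
  Incident i j φ ψ = to φ (F (ix i)) ≤ᴾ to ψ (F (ix j))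
  Factorisation i j φ ψ = ∃ λ α → ∃ λ β → Γ⁺-succ P Γ F i α × Γ⁻-pred P Γ F j β ×
                            _≈ᴬ_ P (_∘ᴬ_ P φ (_⁻¹ᴬ P ψ)) (_∘ᴬ_ P α β)
  CosetsMeet i j φ ψ = ∃ λ χ → (∃ λ α → Γ-at P Γ F i α × _≈ᴬ_ P χ (_∘ᴬ_ P α φ))
                              × (∃ λ β → Γ-at P Γ F j β × _≈ᴬ_ P χ (_∘ᴬ_ P β ψ))

  -- (a) ⇒ (b): with γ = φψ⁻¹ we have F_i γ ≤ F_j; factor γ = αβ at this incidence,
  -- where β fixes F_j, …, F_n and α = γβ⁻¹ fixes F_{−1}, …, F_i.
  incident⇒factorisation : ∀ i j {φ ψ} → Γ φ → Γ ψ → Incident i j φ ψ → Factorisation i j φ ψ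
  incident⇒factorisation i j {φ} {ψ} Γφ Γψ incident
    with factor-at-incidence {_∘ᴬ_ P φ (_⁻¹ᴬ P ψ)}
           (subst (from ψ (to φ (F (ix i))) ≤ᴾ_) (from-to ψ _) (from-mono ψ incident))
  ... | β , Γβ , β-fixes , γ-agrees =
      α , β , upper-stabiliser i Γα α-fixes , lower-stabiliser j Γβ β-fixes
    , λ x → sym (to-from β (to γ x))
    where
      γ α : Aut P
      γ = _∘ᴬ_ P φ (_⁻¹ᴬ P ψ)
      α = _∘ᴬ_ P γ (_⁻¹ᴬ P β)
      Γα : Γ α
      Γα = SG.∘∈ (SG.∘∈ Γφ (SG.⁻¹∈ Γψ)) (SG.⁻¹∈ Γβ)
      α-fixes : ∀ k → toℕ k ≤ toℕ (ix i) → to α (F k) ≡ F k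
      α-fixes k k≤I = trans (cong (from β) (γ-agrees k k≤I)) (from-to β (F k))

  -- (b) ⇒ (a): F_i φψ⁻¹ = F_i αβ = F_i β ≤ F_j β = F_j.
  factorisation⇒incident : ∀ i j {φ ψ} → toℕ i ≤ toℕ j → Factorisation i j φ ψ → Incident i j φ ψ
  factorisation⇒incident i j {φ} {ψ} i≤j (α , β , α∈ , β∈ , φψ⁻¹≈αβ) =
    subst (_≤ᴾ to ψ (F (ix j))) (to-from ψ (to φ (F (ix i)))) (to-mono ψ moved-below)
    where
      image-i : from ψ (to φ (F (ix i))) ≡ to β (F (ix i))
      image-i = trans (φψ⁻¹≈αβ (F (ix i))) (cong (to β) (ΓI-fixes (ix i) (ix-not-upper i) (λ ()) α∈))
      moved-below : from ψ (to φ (F (ix i))) ≤ᴾ F (ix j)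
      moved-below = subst₂ _≤ᴾ_ (sym image-i) (ΓI-fixes (ix j) (ix-not-lower j) (λ ()) β∈)
                      (to-mono β (F-monotone (ix-monotone i≤j)))

  -- (b) ⇒ (c): χ = α⁻¹φ = βψ, and Γ⁺_{i+1} ⊆ Γ_i, Γ⁻_{j−1} ⊆ Γ_j.
  factorisation⇒cosets-meet : ∀ i j {φ ψ} → Factorisation i j φ ψ → CosetsMeet i j φ ψ
  factorisation⇒cosets-meet i j {φ} {ψ} (α , β , α∈ , β∈ , φψ⁻¹≈αβ) =
      _∘ᴬ_ P (_⁻¹ᴬ P α) φ
    , (_⁻¹ᴬ P α , ginv (ΓI-mono (λ { k le refl → ix-not-upper i le }) (λ ()) α∈) , λ _ → refl)
    , (β , ΓI-mono (λ { k le refl → ix-not-lower j le }) (λ ()) β∈ , χ≈βψ)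
    where
      χ≈βψ : ∀ x → to φ (from α x) ≡ to ψ (to β x)
      χ≈βψ x = trans (sym (to-from ψ (to φ (from α x))))
                     (cong (to ψ) (trans (φψ⁻¹≈αβ (from α x)) (cong (to β) (to-from α x))))

  -- (c) ⇒ (a): F_i φ = F_i χ ≤ F_j χ = F_j ψ, since Γ_i fixes F_i and Γ_j fixes F_j.
  cosets-meet⇒incident : ∀ i j {φ ψ} → toℕ i ≤ toℕ j → CosetsMeet i j φ ψ → Incident i j φ ψ
  cosets-meet⇒incident i j {φ} {ψ} i≤j (χ , (α , α∈ , χ≈αφ) , (β , β∈ , χ≈βψ)) =
    subst₂ _≤ᴾ_ χ-at-i χ-at-j (to-mono χ (F-monotone (ix-monotone i≤j)))
    where
      χ-at-i : to χ (F (ix i)) ≡ to φ (F (ix i))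
      χ-at-i = trans (χ≈αφ _) (cong (to φ) (ΓI-fixes (ix i) (λ ne → ne refl) (λ ()) α∈))
      χ-at-j : to χ (F (ix j)) ≡ to ψ (F (ix j))
      χ-at-j = trans (χ≈βψ _) (cong (to ψ) (ΓI-fixes (ix j) (λ ne → ne refl) (λ ()) β∈))

lemma3p6 : (P : PosetR) (n : ℕ) → 1 ≤ n → IsIncidenceComplex P n → IsRegular P →
           (Γ : Aut P → Set) → IsSubgroup P Γ → FlagTransitive P Γ →
           (F : Fin (2 Data.Nat.+ n) → PosetR.Carrier P) → IsBaseFlag P n F →
           (i j : Fin n) → i ≤ᶠ j → (φ ψ : Aut P) → Γ φ → Γ ψ →
           (PosetR._≤ᴾ_ P (_·_ P (face P Γ F i) φ) (_·_ P (face P Γ F j) ψ)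
             ⇔ (∃ λ α → ∃ λ β → Γ⁺-succ P Γ F i α × Γ⁻-pred P Γ F j β ×
                 _≈ᴬ_ P (_∘ᴬ_ P φ (_⁻¹ᴬ P ψ)) (_∘ᴬ_ P α β)))
           × ((∃ λ α → ∃ λ β → Γ⁺-succ P Γ F i α × Γ⁻-pred P Γ F j β ×
                 _≈ᴬ_ P (_∘ᴬ_ P φ (_⁻¹ᴬ P ψ)) (_∘ᴬ_ P α β))
             ⇔ (∃ λ χ → (∃ λ α → Γ-at P Γ F i α × _≈ᴬ_ P χ (_∘ᴬ_ P α φ))
                       × (∃ λ β → Γ-at P Γ F j β × _≈ᴬ_ P χ (_∘ᴬ_ P β ψ))))
lemma3p6 P n _ K _ Γ sg ft F bf i j i≤j φ ψ Γφ Γψ =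
    mk⇔ (incident⇒factorisation i j Γφ Γψ) (factorisation⇒incident i j {φ} {ψ} i≤j)
  , mk⇔ (factorisation⇒cosets-meet i j {φ} {ψ})
        (λ meet → incident⇒factorisation i j Γφ Γψ (cosets-meet⇒incident i j {φ} {ψ} i≤j meet))
  where open CosetGeometry P n K Γ sg ft F bf
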